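{- Let $p\geq 2$ and let $V_1,\dots,V_p$ be pairwise disjoint finite sets. For each $i=1,\dots,p$ let $\mathcal{H}_i\subseteq 2^{V_i}$ be a hypergraph on $V_i$ which either is JM+ or is of the form $\mathcal{H}_i=\{\{a_i\},\{b_i\}\}$ with $V_i=\{a_i,b_i\}$, $a_i\neq b_i$ (a copy of $\binom{[2]}{1}$). Then the conjunctive compound $\mathcal{H}_1\otimes\dots\otimes\mathcal{H}_p$ is a JM+ hypergraph on $V_1\cup\dots\cup V_p$.
   Context: A hypergraph on a finite set $V$ is a family $\mathcal{H}\subseteq 2^V$ of nonempty subsets (edges) with $\bigcup_{H\in\mathcal{H}}H=V$. Positions are vectors $\mathbf{x}\in\mathbb{Z}_{+}^V$ ($\mathbb{Z}_+$ = nonnegative integers). In the game Nim$_\mathcal{H}$, a move $\mathbf{x}\to\mathbf{x}'$ (an $H$-move) consists of choosing an edge $H\in\mathcal{H}$ and passing to a position $\mathbf{x}'$ with $x'_i<x_i$ for $i\in H$ and $x'_i=x_i$ for $i\notin H$. The height $h_\mathcal{H}(\mathbf{x})$ is the maximum number of consecutive moves that can be made starting from $\mathbf{x}$. Let $m(\mathbf{x})=\min_{i\in V}x_i$. Properties: (A) An edge $H\in\mathcal{H}$ is transversal if $H\cap H'\neq\emptyset$ for all $H'\in\mathcal{H}$; $\mathcal{H}$ is transversal-free if it has no transversal edge. For $S\subseteq V$, $\mathcal{H}_S=\{H\in\mathcal{H}\mid H\subseteq S\}$. $\mathcal{H}$ satisfies (A) (is minimal transversal-free) if it is transversal-free but for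 every proper subset $S\subsetneq V$ with $\mathcal{H}_S\neq\emptyset$, $\mathcal{H}_S$ has a transversal edge (an edge of $\mathcal{H}_S$ meeting all edges of $\mathcal{H}_S$). (B) $\mathcal{H}$ is minimum-decreasing if for every position $\mathbf{x}$ with $m(\mathbf{x})>0$ there is a move $\mathbf{x}\to\mathbf{x}'$ with $m(\mathbf{x}')<m(\mathbf{x})$, $h_\mathcal{H}(\mathbf{x}')=h_\mathcal{H}(\mathbf{x})-1$ and $x_i-x'_i\leq 1$ for all $i\in V$. (C) A sequence of edges $H_0,\dots,H_q$ is a chain if for all $i=0,\dots,q-1$: $H_{i+1}\cap H_i\neq\emptyset$, $|H_{i+1}\setminus H_i|=1$, and $H_i\subseteq H_0\cup H_q$; $\mathcal{H}$ has the chain property if for any two distinct edges $H,H'$ there is a chain with $H_0=H$, $H_q=H'$. $\mathcal{H}$ is JM+ if it satisfies (A), (B) and (C). For hypergraphs $\mathcal{H}_i\subseteq 2^{V_i}$ on pairwise disjoint sets, the conjunctive compound is $\mathcal{H}_1\otimes\dots\otimes\mathcal{H}_p=\{\bigcup_{i=1}^p H^i\mid H^i\in\mathcal{H}_i,\ i=1,\dots,p\}$. -}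

module Defs where

open import Data.Nat using (ℕ; zero; suc; _≤_; _<_)
open import Data.Bool using (Bool; true; false)
open import Data.Fin using (Fin) renaming (zero to fzero; suc to fsuc)
open import Data.Fin.Base using (inject₁)
open import Data.Product using (Σ; ∃; _×_; _,_)
open import Data.Sum using (_⊎_)
open import Data.Empty using (⊥)
open import Relation.Nullary using (¬_)
open import Relation.Binary.PropositionalEquality using (_≡_; _≢_)

Sub : Set → Set
Sub V = V → Bool

-- A family of subsets of V (edges), given by a membership predicate.
-- All notions below only use edges up to pointwise equality.
Family : Set → Set₁
Family V = Sub V → Set

_≐_ : {V : Set} → Sub V → Sub V → Set
A ≐ B = ∀ v → A v ≡ B v

_⊆_ : {V : Set} → Sub V → Sub V → Set
A ⊆ B = ∀ v → A v ≡ true → B v ≡ true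

Meets : {V : Set} → Sub V → Sub V → Set
Meets A B = ∃ λ v → A v ≡ true × B v ≡ true

IsHypergraph : {V : Set} → Family V → Set
IsHypergraph {V} ℋ =
  (∀ H → ℋ H → ∃ λ v → H v ≡ true) × (∀ (v : V) → ∃ λ H → ℋ H × H v ≡ true)

Position : Set → Set
Position V = V → ℕ

Move : {V : Set} → Family V → Position V → Position V → Set
Move ℋ x x' = ∃ λ H → ℋ H ×
  (∀ v → (H v ≡ true → x' v < x v) × (H v ≡ false → x' v ≡ x v))

data Play {V : Set} (ℋ : Family V) : Position V → ℕ → Set where
  done : ∀ {x} → Play ℋ x zero
  step : ∀ {x x' k} → Move ℋ x x' → Play ℋ x' k → Play ℋ x (suc k)

IsHeight : {V : Set} → Family V → Position V → ℕ → Set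
IsHeight ℋ x k = Play ℋ x k × (∀ j → Play ℋ x j → j ≤ k)

IsTransversal : {V : Set} → Family V → Sub V → Set
IsTransversal ℋ H = ℋ H × (∀ H' → ℋ H' → Meets H H')

HasTransversal : {V : Set} → Family V → Set
HasTransversal ℋ = ∃ λ H → IsTransversal ℋ H

TransversalFree : {V : Set} → Family V → Set
TransversalFree ℋ = ¬ HasTransversal ℋ

Restrict : {V : Set} → Family V → Sub V → Family V
Restrict ℋ S H = ℋ H × H ⊆ S

PropA : {V : Set} → Family V → Set
PropA {V} ℋ = TransversalFree ℋ ×
  (∀ (S : Sub V) → (∃ λ v → S v ≡ false) →
     (∃ λ H → Restrict ℋ S H) → HasTransversal (Restrict ℋ S))

-- (B) minimum-decreasing.  m(x) = min_i x_i ; for nonempty V: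
--   m(x) > 0      ⇔  ∀ i, 0 < x_i
--   m(x') < m(x)  ⇔  ∃ j, ∀ i, x'_j < x_i
-- h(x') = h(x) - 1 with h(x) ≥ 1 (forced since m(x) > 0 and a move exists)
-- is expressed as: for some k, h(x) = k+1 and h(x') = k.
PropB : {V : Set} → Family V → Set
PropB {V} ℋ = ∀ (x : Position V) → (∀ i → 0 < x i) →
  ∃ λ x' → Move ℋ x x' ×
    (∃ λ j → ∀ i → x' j < x i) ×
    (∃ λ k → IsHeight ℋ x (suc k) × IsHeight ℋ x' k) ×
    (∀ i → x i ≤ suc (x' i))

DiffIsOne : {V : Set} → Sub V → Sub V → Set
DiffIsOne A B = ∃ λ v → (B v ≡ true × A v ≡ false) ×
  (∀ w → B w ≡ true → A w ≡ false → w ≡ v)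

_∪_ : {V : Set} → Sub V → Sub V → Sub V
(A ∪ B) v = Data.Bool._∨_ (A v) (B v)

IsChain : {V : Set} → Family V → (q : ℕ) → (Fin (suc q) → Sub V) → Set
IsChain ℋ q Hs = (∀ i → ℋ (Hs i)) ×
  (∀ (i : Fin q) → Meets (Hs (fsuc i)) (Hs (inject₁ i))
                 × DiffIsOne (Hs (inject₁ i)) (Hs (fsuc i))
                 × Hs (inject₁ i) ⊆ (Hs fzero ∪ Hs (Data.Fin.fromℕ q)))

ChainProperty : {V : Set} → Family V → Set
ChainProperty ℋ = ∀ H H' → ℋ H → ℋ H' → ¬ (H ≐ H') →
  ∃ λ q → ∃ λ (Hs : Fin (suc q) → Sub _) →
    IsChain ℋ q Hs × (Hs fzero ≐ H) × (Hs (Data.Fin.fromℕ q) ≐ H')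

JMplus : {V : Set} → Family V → Set
JMplus ℋ = PropA ℋ × PropB ℋ × ChainProperty ℋ

IsSingletonEdge : {V : Set} → V → Sub V → Set
IsSingletonEdge a H = ∀ v → (H v ≡ true → v ≡ a) × (v ≡ a → H v ≡ true)

IsTwoChooseOne : {V : Set} → Family V → Set
IsTwoChooseOne {V} ℋ = ∃ λ (a : V) → ∃ λ (b : V) → a ≢ b ×
  (∀ v → v ≡ a ⊎ v ≡ b) ×
  (∀ H → (ℋ H → IsSingletonEdge a H ⊎ IsSingletonEdge b H)
       × (IsSingletonEdge a H ⊎ IsSingletonEdge b H → ℋ H))

Union : (p : ℕ) → (Fin p → ℕ) → Set
Union p n = Σ (Fin p) (λ i → Fin (n i))

Compound : (p : ℕ) (n : Fin p → ℕ) → ((i : Fin p) → Family (Fin (n i))) →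
           Family (Union p n)
Compound p n ℋ E = ∃ λ (Hs : (i : Fin p) → Sub (Fin (n i))) →
  (∀ i → ℋ i (Hs i)) × (∀ i v → E (i , v) ≡ Hs i v)

-- A move of the compound is a tuple of moves of the factors, so its height is the minimum of
-- the heights of the factors, and a minimum-decreasing move made in all factors at once is
-- minimum-decreasing for the compound (B).  If no component of an edge is a transversal of its
-- factor, choosing a disjoint edge in every factor gives a compound edge disjoint from it; and
-- for S missing a vertex of factor i, a transversal of the restriction of that factor, completed
-- by the other components of any edge inside S, is a transversal of the restricted compound (A).
-- Chains are built by replacing the components one factor at a time along a path of that
-- factor; because p ≥ 2, consecutive edges always meet in an untouched factor, which is also
-- what lets the two disjoint edges of a copy of (2 choose 1) be linked (C).  A copy of
-- (2 choose 1) has height x a + x b, and lowering the smaller of x a, x b is minimum-decreasing.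

module Submission where

open import Defs
open import Data.Bool using (true; false; _∨_)
import Data.Bool.Properties as Bool
open import Data.Empty using (⊥-elim)
open import Data.Fin using (Fin; toℕ; fromℕ; fromℕ<; inject₁) renaming (zero to fzero; suc to fsuc)
open import Data.Fin.Properties
  using (any?; all?; ∀-cons; sequence; toℕ<n; toℕ-fromℕ<; toℕ-injective)
import Data.Fin.Properties as Fin
open import Data.List using (allFin)
open import Data.List.Extrema.Nat using (argmin; f[argmin]≤f[xs])
open import Data.List.Membership.Propositional.Properties using (∈-allFin)
import Data.List.Relation.Unary.All as All
open import Data.Nat using (ℕ; zero; suc; pred; _+_; _≤_; _<_; z≤n; s≤s; z<s; _≤?_; _<?_; >-nonZero)
open import Data.Nat.Properties
open import Data.Product using (∃; _×_; _,_; proj₁; proj₂; curry)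
open import Data.Sum using (_⊎_; inj₁; inj₂)
import Data.Sum as Sum
open import Data.Vec.Functional using (updateAt; _∷_)
open import Data.Vec.Functional.Properties using (updateAt-updates; updateAt-minimal)
open import Effect.Monad using (RawMonad)
open import Function using (_∘_; id; mk⇔)
open import Relation.Nullary using (¬_; Dec; yes; no; contradiction)
open import Relation.Nullary.Decidable using (isYes; decidable-stable; _×-dec_)
open import Relation.Nullary.Negation using (¬¬-Monad)
open import Relation.Binary.PropositionalEquality

module _ {V : Set} where

  ≐-sym : {A B : Sub V} → A ≐ B → B ≐ A
  ≐-sym A≐B v = sym (A≐B v)

  ≐-trans : {A B C : Sub V} → A ≐ B → B ≐ C → A ≐ C
  ≐-trans A≐B B≐C v = trans (A≐B v) (B≐C v)

  ∪-cong : {A A' B B' : Sub V} → A ≐ A' → B ≐ B' → (A ∪ B) ≐ (A' ∪ B')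
  ∪-cong A≐A' B≐B' v = cong₂ _∨_ (A≐A' v) (B≐B' v)

  ⊆-∪ˡ : (A B : Sub V) → A ⊆ (A ∪ B)
  ⊆-∪ˡ A B v Av = cong (_∨ B v) Av

  ⊆-∪ʳ : (A B : Sub V) → B ⊆ (A ∪ B)
  ⊆-∪ʳ A B v Bv = trans (cong (A v ∨_) Bv) (Bool.∨-zeroʳ (A v))

  ⊆-respˡ : {A A' B : Sub V} → A ≐ A' → A ⊆ B → A' ⊆ B
  ⊆-respˡ A≐A' A⊆B v A'v = A⊆B v (trans (A≐A' v) A'v)

  ⊆-respʳ : {A B B' : Sub V} → B ≐ B' → A ⊆ B → A ⊆ B'
  ⊆-respʳ B≐B' A⊆B v Av = trans (sym (B≐B' v)) (A⊆B v Av)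

Meets? : ∀ {m} (A B : Sub (Fin m)) → Dec (Meets A B)
Meets? A B = any? (λ v → (A v Bool.≟ true) ×-dec (B v Bool.≟ true))

transversalFree⇒¬¬disjoint : ∀ {m} {ℋ : Family (Fin m)} {H} → TransversalFree ℋ → ℋ H →
  ¬ ¬ (∃ λ D → ℋ D × ¬ Meets H D)
transversalFree⇒¬¬disjoint {ℋ = ℋ} {H} free H∈ℋ noDisjoint = free (H , H∈ℋ , meetsAll)
  where
  meetsAll : ∀ D → ℋ D → Meets H D
  meetsAll D D∈ℋ = decidable-stable (Meets? H D) (λ ¬meets → noDisjoint (D , D∈ℋ , ¬meets))

-- PropA ℋ unfolds to TransversalFree ℋ × RestrictionsHaveTransversals ℋ.
RestrictionsHaveTransversals : {V : Set} → Family V → Set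
RestrictionsHaveTransversals {V} ℋ = ∀ (S : Sub V) → (∃ λ v → S v ≡ false) →
  (∃ λ H → Restrict ℋ S H) → HasTransversal (Restrict ℋ S)

-- PropB ℋ unfolds to ∀ x → (∀ i → 0 < x i) → ∃ (MinimumDecreasingMove ℋ x).
MinimumDecreasingMove : {V : Set} → Family V → Position V → Position V → Set
MinimumDecreasingMove ℋ x x' = Move ℋ x x' ×
  (∃ λ j → ∀ i → x' j < x i) ×
  (∃ λ k → IsHeight ℋ x (suc k) × IsHeight ℋ x' k) ×
  (∀ i → x i ≤ suc (x' i))

Play-truncate : ∀ {V} {ℋ : Family V} {x j k} → j ≤ k → Play ℋ x k → Play ℋ x j
Play-truncate z≤n       _                = done
Play-truncate (s≤s j≤k) (step move play) = step move (Play-truncate j≤k play)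

Play-uncons : ∀ {V} {ℋ : Family V} {x k} → Play ℋ x (suc k) →
  ∃ λ x' → Move ℋ x x' × Play ℋ x' k
Play-uncons (step move play) = _ , move , play

measure⇒isHeight : ∀ {V} {ℋ : Family V} (μ : Position V → ℕ) →
  (∀ {x x'} → Move ℋ x x' → μ x' < μ x) →
  (∀ x {k} → μ x ≡ suc k → ∃ λ x' → Move ℋ x x' × μ x' ≡ k) →
  ∀ x → IsHeight ℋ x (μ x)
measure⇒isHeight {ℋ = ℋ} μ decreases decrements x = play (μ x) x refl , bounded
  where
  play : ∀ k x → μ x ≡ k → Play ℋ x k
  play zero    x _    = done
  play (suc k) x μx≡k with decrements x μx≡k
  ... | x' , move , μx'≡k = step move (play k x' μx'≡k)

  bounded : ∀ {x} j → Play ℋ x j → j ≤ μ x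
  bounded zero    done             = z≤n
  bounded (suc j) (step move rest) = ≤-trans (s≤s (bounded j rest)) (decreases move)

propB⇒edge : ∀ {m} {ℋ : Family (Fin m)} → PropB ℋ → ∃ λ H → ℋ H
propB⇒edge minDecreasing with minDecreasing (λ _ → 1) (λ _ → z<s)
... | _ , (H , H∈ℋ , _) , _ = H , H∈ℋ

-- Chains as paths

module _ {V : Set} where

  DiffStep : Sub V → Sub V → Sub V → Set
  DiffStep U A B = DiffIsOne A B × A ⊆ U

  ChainStep : Sub V → Sub V → Sub V → Set
  ChainStep U A B = Meets B A × DiffStep U A B

  -- IsChain ℋ q Hs is definitionally IsChainIn ℋ (Hs fzero ∪ Hs (fromℕ q)) q Hs.
  IsChainIn : Family V → Sub V → (q : ℕ) → (Fin (suc q) → Sub V) → Set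
  IsChainIn ℋ U q Hs =
    (∀ i → ℋ (Hs i)) × (∀ (i : Fin q) → ChainStep U (Hs (inject₁ i)) (Hs (fsuc i)))

  ChainStep-respˡ : ∀ {U A A' B} → A ≐ A' → ChainStep U A B → ChainStep U A' B
  ChainStep-respˡ A≐A' ((v , Bv , Av) , (w , (Bw , Aw) , unique) , A⊆U) =
    (v , Bv , trans (sym (A≐A' v)) Av) ,
    (w , (Bw , trans (sym (A≐A' w)) Aw) , λ u Bu A'u → unique u Bu (trans (A≐A' u) A'u)) ,
    ⊆-respˡ A≐A' A⊆U

data Path {V : Set} (ℋ : Family V) (R : Sub V → Sub V → Set) : Sub V → Sub V → Set where
  stop : ∀ {A B} → ℋ A → A ≐ B → Path ℋ R A B
  link : ∀ {A B C} → ℋ A → R A B → Path ℋ R B C → Path ℋ R A C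

module _ {V : Set} {ℋ : Family V} {R : Sub V → Sub V → Set} where

  Path-respʳ : ∀ {A C C'} → C ≐ C' → Path ℋ R A C → Path ℋ R A C'
  Path-respʳ C≐C' (stop A∈ℋ A≐C)    = stop A∈ℋ (≐-trans A≐C C≐C')
  Path-respʳ C≐C' (link A∈ℋ r rest) = link A∈ℋ r (Path-respʳ C≐C' rest)

  Path-map : ∀ {W} {𝒢 : Family W} {S : Sub W → Sub W → Set} (f : Sub V → Sub W) →
    (∀ {A B} → A ≐ B → f A ≐ f B) → (∀ {A} → ℋ A → 𝒢 (f A)) →
    (∀ {A B} → R A B → S (f A) (f B)) →
    ∀ {A B} → Path ℋ R A B → Path 𝒢 S (f A) (f B)
  Path-map f f-cong f-∈ f-step (stop A∈ℋ A≐B)    = stop (f-∈ A∈ℋ) (f-cong A≐B)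
  Path-map f f-cong f-∈ f-step (link A∈ℋ r rest) =
    link (f-∈ A∈ℋ) (f-step r) (Path-map f f-cong f-∈ f-step rest)

  module Concat (ℋ-resp : ∀ {A A'} → A ≐ A' → ℋ A → ℋ A')
                (R-respˡ : ∀ {A A' B} → A ≐ A' → R A B → R A' B) where

    Path-respˡ : ∀ {A A' C} → A ≐ A' → Path ℋ R A C → Path ℋ R A' C
    Path-respˡ A≐A' (stop A∈ℋ A≐C)    = stop (ℋ-resp A≐A' A∈ℋ) (≐-trans (≐-sym A≐A') A≐C)
    Path-respˡ A≐A' (link A∈ℋ r rest) = link (ℋ-resp A≐A' A∈ℋ) (R-respˡ A≐A' r) rest

    _++_ : ∀ {A B C} → Path ℋ R A B → Path ℋ R B C → Path ℋ R A C
    stop _ A≐B      ++ path = Path-respˡ (≐-sym A≐B) path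
    link A∈ℋ r rest ++ path = link A∈ℋ r (rest ++ path)

-- Unlike a chain, consecutive edges need not meet: in the compound they meet in another factor.
Linked : {V : Set} → Family V → Set
Linked ℋ = ∀ H H' → ℋ H → ℋ H' → ∃ λ A → A ≐ H × Path ℋ (DiffStep (H ∪ H')) A H'

module _ {V : Set} {ℋ : Family V} {U : Sub V} where

  chain⇒path : ∀ q {Hs} → IsChainIn ℋ U q Hs → Path ℋ (ChainStep U) (Hs fzero) (Hs (fromℕ q))
  chain⇒path zero         (∈ℋ , _)     = stop (∈ℋ fzero) (λ _ → refl)
  chain⇒path (suc q) {Hs} (∈ℋ , steps) =
    link (∈ℋ fzero) (steps fzero) (chain⇒path q {Hs ∘ fsuc} (∈ℋ ∘ fsuc , steps ∘ fsuc))

  path⇒chain : ∀ {A B} → Path ℋ (ChainStep U) A B →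
    ∃ λ q → ∃ λ (Hs : Fin (suc q) → Sub V) →
      IsChainIn ℋ U q Hs × Hs fzero ≡ A × Hs (fromℕ q) ≐ B
  path⇒chain {A} (stop A∈ℋ A≐B) = 0 , (λ _ → A) , ((λ _ → A∈ℋ) , λ ()) , refl , A≐B
  path⇒chain {A} (link A∈ℋ A→B rest) with path⇒chain rest
  ... | q , Hs , (∈ℋ , steps) , refl , end =
    suc q , A ∷ Hs , (∀-cons A∈ℋ ∈ℋ , ∀-cons A→B steps) , refl , end

chainProperty⇒linked : ∀ {m} {ℋ : Family (Fin m)} → ChainProperty ℋ → Linked ℋ
chainProperty⇒linked chain H H' H∈ℋ H'∈ℋ with all? (λ v → H v Bool.≟ H' v)
... | yes H≐H' = H , (λ _ → refl) , stop H∈ℋ H≐H'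
... | no  H≉H' with chain H H' H∈ℋ H'∈ℋ H≉H'
...   | q , Hs , isChain , first≐H , last≐H' =
  Hs fzero , first≐H , Path-respʳ last≐H' (Path-map id id id forget-meets (chain⇒path q isChain))
  where
  forget-meets : ∀ {A B} → ChainStep (Hs fzero ∪ Hs (fromℕ q)) A B → DiffStep (H ∪ H') A B
  forget-meets (_ , A→B , A⊆U) = A→B , ⊆-respʳ (∪-cong first≐H last≐H') A⊆U

-- Copies of (2 choose 1)

module _ {V : Set} where

  singleton-true : ∀ {c : V} {A} → IsSingletonEdge c A → A c ≡ true
  singleton-true {c} A≡⁅c⁆ = proj₂ (A≡⁅c⁆ c) refl

  singleton-false : ∀ {c : V} {A v} → IsSingletonEdge c A → v ≢ c → A v ≡ false
  singleton-false {v = v} A≡⁅c⁆ v≢c = Bool.¬-not (v≢c ∘ proj₁ (A≡⁅c⁆ v))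

  singletons-≐ : ∀ {c : V} {A B} → IsSingletonEdge c A → IsSingletonEdge c B → A ≐ B
  singletons-≐ A≡⁅c⁆ B≡⁅c⁆ v =
    Bool.⇔→≡ (mk⇔ (proj₂ (B≡⁅c⁆ v) ∘ proj₁ (A≡⁅c⁆ v)) (proj₂ (A≡⁅c⁆ v) ∘ proj₁ (B≡⁅c⁆ v)))

  singletons-meet : ∀ {c : V} {A B} → IsSingletonEdge c A → IsSingletonEdge c B → Meets A B
  singletons-meet {c} A≡⁅c⁆ B≡⁅c⁆ = c , singleton-true A≡⁅c⁆ , singleton-true B≡⁅c⁆

  singletons-disjoint : ∀ {c d : V} {A B} → c ≢ d → IsSingletonEdge c A → IsSingletonEdge d B →
    ¬ Meets A B
  singletons-disjoint c≢d A≡⁅c⁆ B≡⁅d⁆ (v , Av , Bv) =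
    c≢d (trans (sym (proj₁ (A≡⁅c⁆ v) Av)) (proj₁ (B≡⁅d⁆ v) Bv))

  singletons-diffIsOne : ∀ {c d : V} {A B} → c ≢ d → IsSingletonEdge c A → IsSingletonEdge d B →
    DiffIsOne A B
  singletons-diffIsOne {d = d} c≢d A≡⁅c⁆ B≡⁅d⁆ =
    d , (singleton-true B≡⁅d⁆ , singleton-false A≡⁅c⁆ (c≢d ∘ sym)) , λ w Bw _ → proj₁ (B≡⁅d⁆ w) Bw

⁅_⁆ : ∀ {m} → Fin m → Sub (Fin m)
⁅ c ⁆ v = isYes (v Fin.≟ c)

⁅⁆-isSingletonEdge : ∀ {m} (c : Fin m) → IsSingletonEdge c ⁅ c ⁆
⁅⁆-isSingletonEdge c v with v Fin.≟ c
... | yes v≡c = (λ _ → v≡c) , (λ _ → refl)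
... | no  v≢c = (λ ()) , (λ v≡c → contradiction v≡c v≢c)

module _ {m} (x : Position (Fin m)) (c : Fin m) (x₍c₎>0 : 0 < x c) where

  decrement-at : suc (updateAt x c pred c) ≡ x c
  decrement-at = trans (cong suc (updateAt-updates c x)) (suc-pred (x c) {{>-nonZero x₍c₎>0}})

  decrement-≤ : ∀ v → x v ≤ suc (updateAt x c pred v)
  decrement-≤ v with v Fin.≟ c
  ... | yes refl = ≤-reflexive (sym decrement-at)
  ... | no  v≢c  = subst (λ y → x v ≤ suc y) (sym (updateAt-minimal v c x v≢c)) (n≤1+n (x v))

  decrement-move : ∀ {ℋ : Family (Fin m)} {H} → ℋ H → IsSingletonEdge c H →
    Move ℋ x (updateAt x c pred)
  decrement-move {H = H} H∈ℋ H≡⁅c⁆ = H , H∈ℋ , λ v → at v , off v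
    where
    at : ∀ v → H v ≡ true → updateAt x c pred v < x v
    at v Hv with proj₁ (H≡⁅c⁆ v) Hv
    ... | refl = ≤-reflexive decrement-at
    off : ∀ v → H v ≡ false → updateAt x c pred v ≡ x v
    off v ¬Hv = updateAt-minimal v c x (λ v≡c → Bool.not-¬ (proj₂ (H≡⁅c⁆ v) v≡c) ¬Hv)

swap-TwoChooseOne : ∀ {m} {ℋ : Family (Fin m)} → IsTwoChooseOne ℋ → IsTwoChooseOne ℋ
swap-TwoChooseOne (a , b , a≢b , a-or-b , edge⇔) =
  b , a , a≢b ∘ sym , Sum.swap ∘ a-or-b ,
  λ H → Sum.swap ∘ proj₁ (edge⇔ H) , proj₂ (edge⇔ H) ∘ Sum.swap

module TwoChooseOne {m} {ℋ : Family (Fin m)} (two : IsTwoChooseOne ℋ) where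

  a b : Fin m
  a = proj₁ two
  b = proj₁ (proj₂ two)

  a≢b : a ≢ b
  a≢b = proj₁ (proj₂ (proj₂ two))

  a-or-b : ∀ v → v ≡ a ⊎ v ≡ b
  a-or-b = proj₁ (proj₂ (proj₂ (proj₂ two)))

  edge⇒singleton : ∀ {H} → ℋ H → IsSingletonEdge a H ⊎ IsSingletonEdge b H
  edge⇒singleton {H} = proj₁ (proj₂ (proj₂ (proj₂ (proj₂ two))) H)

  a-edge : ℋ ⁅ a ⁆
  a-edge = proj₂ (proj₂ (proj₂ (proj₂ (proj₂ two))) ⁅ a ⁆) (inj₁ (⁅⁆-isSingletonEdge a))

  b-edge : ℋ ⁅ b ⁆
  b-edge = proj₂ (proj₂ (proj₂ (proj₂ (proj₂ two))) ⁅ b ⁆) (inj₂ (⁅⁆-isSingletonEdge b))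

  μ : Position (Fin m) → ℕ
  μ x = x a + x b

  move-decreases : ∀ {x x'} → Move ℋ x x' → μ x' < μ x
  move-decreases (H , H∈ℋ , moves) with edge⇒singleton H∈ℋ
  ... | inj₁ H≡⁅a⁆ = +-mono-<-≤ (proj₁ (moves a) (singleton-true H≡⁅a⁆))
                       (≤-reflexive (proj₂ (moves b) (singleton-false H≡⁅a⁆ (a≢b ∘ sym))))
  ... | inj₂ H≡⁅b⁆ = +-mono-≤-< (≤-reflexive (proj₂ (moves a) (singleton-false H≡⁅b⁆ a≢b)))
                       (proj₁ (moves b) (singleton-true H≡⁅b⁆))

  μ-decrement-a : ∀ {x} (x₍a₎>0 : 0 < x a) → suc (μ (updateAt x a pred)) ≡ μ x
  μ-decrement-a {x} x₍a₎>0 =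
    cong₂ _+_ (decrement-at x a x₍a₎>0) (updateAt-minimal b a x (a≢b ∘ sym))

  μ-decrement-b : ∀ {x} (x₍b₎>0 : 0 < x b) → suc (μ (updateAt x b pred)) ≡ μ x
  μ-decrement-b {x} x₍b₎>0 =
    trans (sym (+-suc _ _)) (cong₂ _+_ (updateAt-minimal a b x a≢b) (decrement-at x b x₍b₎>0))

  move-decrements : ∀ x {k} → μ x ≡ suc k → ∃ λ x' → Move ℋ x x' × μ x' ≡ k
  move-decrements x {k} μx≡1+k with 0 <? x a
  ... | yes x₍a₎>0 = _ , decrement-move x a x₍a₎>0 a-edge (⁅⁆-isSingletonEdge a) ,
                     suc-injective (trans (μ-decrement-a x₍a₎>0) μx≡1+k)
  ... | no  x₍a₎≯0 = _ , decrement-move x b x₍b₎>0 b-edge (⁅⁆-isSingletonEdge b) ,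
                     suc-injective (trans (μ-decrement-b x₍b₎>0) μx≡1+k)
    where
    x₍b₎≡1+k : x b ≡ suc k
    x₍b₎≡1+k = trans (cong (_+ x b) (sym (n≤0⇒n≡0 (≮⇒≥ x₍a₎≯0)))) μx≡1+k
    x₍b₎>0 : 0 < x b
    x₍b₎>0 = subst (0 <_) (sym x₍b₎≡1+k) z<s

  height : ∀ x → IsHeight ℋ x (μ x)
  height = measure⇒isHeight μ move-decreases move-decrements

  minimumDecreasing-at-a : ∀ x → 0 < x a → x a ≤ x b → ∃ λ x' → MinimumDecreasingMove ℋ x x'
  minimumDecreasing-at-a x x₍a₎>0 a≤b =
    x' , decrement-move x a x₍a₎>0 a-edge (⁅⁆-isSingletonEdge a) , (a , below) ,
    (μ x' , subst (IsHeight ℋ x) (sym (μ-decrement-a x₍a₎>0)) (height x) , height x') ,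
    decrement-≤ x a x₍a₎>0
    where
    x' : Position (Fin m)
    x' = updateAt x a pred
    below : ∀ v → x' a < x v
    below v with a-or-b v
    ... | inj₁ refl = ≤-reflexive (decrement-at x a x₍a₎>0)
    ... | inj₂ refl = ≤-trans (≤-reflexive (decrement-at x a x₍a₎>0)) a≤b

  disjoint-from-a-edge : ∀ {H} → IsSingletonEdge a H → ∃ λ D → ℋ D × ¬ Meets H D
  disjoint-from-a-edge H≡⁅a⁆ = ⁅ b ⁆ , b-edge , singletons-disjoint a≢b H≡⁅a⁆ (⁅⁆-isSingletonEdge b)

  a-edge-transversal : ∀ {S H} → (∃ λ v → S v ≡ false) → H ⊆ S → IsSingletonEdge a H →
    ∀ H' → Restrict ℋ S H' → Meets H H'
  a-edge-transversal {S} (v , S₍v₎≡false) H⊆S H≡⁅a⁆ H' (H'∈ℋ , H'⊆S) with edge⇒singleton H'∈ℋ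
  ... | inj₁ H'≡⁅a⁆ = singletons-meet H≡⁅a⁆ H'≡⁅a⁆
  ... | inj₂ H'≡⁅b⁆ = ⊥-elim (Bool.not-¬ (S-full v) S₍v₎≡false)
    where
    S-full : ∀ w → S w ≡ true
    S-full w with a-or-b w
    ... | inj₁ refl = H⊆S a (singleton-true H≡⁅a⁆)
    ... | inj₂ refl = H'⊆S b (singleton-true H'≡⁅b⁆)

module _ {m} {ℋ : Family (Fin m)} (two : IsTwoChooseOne ℋ) where

  private
    module A = TwoChooseOne two
    module B = TwoChooseOne (swap-TwoChooseOne two)

  twoChooseOne-propB : PropB ℋ
  twoChooseOne-propB x x>0 with x A.a ≤? x A.b
  ... | yes a≤b = A.minimumDecreasing-at-a x (x>0 _) a≤b
  ... | no  a≰b = B.minimumDecreasing-at-a x (x>0 _) (<⇒≤ (≰⇒> a≰b))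

  twoChooseOne-disjoint : ∀ {H} → ℋ H → ∃ λ D → ℋ D × ¬ Meets H D
  twoChooseOne-disjoint H∈ℋ with A.edge⇒singleton H∈ℋ
  ... | inj₁ H≡⁅a⁆ = A.disjoint-from-a-edge H≡⁅a⁆
  ... | inj₂ H≡⁅b⁆ = B.disjoint-from-a-edge H≡⁅b⁆

  twoChooseOne-transversalFree : TransversalFree ℋ
  twoChooseOne-transversalFree (H , H∈ℋ , meetsAll) with twoChooseOne-disjoint H∈ℋ
  ... | D , D∈ℋ , ¬meets = ¬meets (meetsAll D D∈ℋ)

  twoChooseOne-restrictions : RestrictionsHaveTransversals ℋ
  twoChooseOne-restrictions S outside (H , H∈ℋ , H⊆S) with A.edge⇒singleton H∈ℋ
  ... | inj₁ H≡⁅a⁆ = H , (H∈ℋ , H⊆S) , A.a-edge-transversal outside H⊆S H≡⁅a⁆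
  ... | inj₂ H≡⁅b⁆ = H , (H∈ℋ , H⊆S) , B.a-edge-transversal outside H⊆S H≡⁅b⁆

  twoChooseOne-linked : Linked ℋ
  twoChooseOne-linked H H' H∈ℋ H'∈ℋ with A.edge⇒singleton H∈ℋ | A.edge⇒singleton H'∈ℋ
  ... | inj₁ H≡⁅a⁆ | inj₁ H'≡⁅a⁆ = H , (λ _ → refl) , stop H∈ℋ (singletons-≐ H≡⁅a⁆ H'≡⁅a⁆)
  ... | inj₂ H≡⁅b⁆ | inj₂ H'≡⁅b⁆ = H , (λ _ → refl) , stop H∈ℋ (singletons-≐ H≡⁅b⁆ H'≡⁅b⁆)
  ... | inj₁ H≡⁅a⁆ | inj₂ H'≡⁅b⁆ = H , (λ _ → refl) ,
    link H∈ℋ (singletons-diffIsOne A.a≢b H≡⁅a⁆ H'≡⁅b⁆ , ⊆-∪ˡ H H') (stop H'∈ℋ (λ _ → refl))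
  ... | inj₂ H≡⁅b⁆ | inj₁ H'≡⁅a⁆ = H , (λ _ → refl) ,
    link H∈ℋ (singletons-diffIsOne B.a≢b H≡⁅b⁆ H'≡⁅a⁆ , ⊆-∪ˡ H H') (stop H'∈ℋ (λ _ → refl))

Tuple : (p : ℕ) → (Fin p → ℕ) → Set
Tuple p n = (i : Fin p) → Sub (Fin (n i))

module _ {p : ℕ} {n : Fin p → ℕ} where

  ⋃ : Tuple p n → Sub (Union p n)
  ⋃ T (i , v) = T i v

  _[_≔_] : Tuple p n → (i : Fin p) → Sub (Fin (n i)) → Tuple p n
  (T [ i ≔ C ]) j with j Fin.≟ i
  ... | yes refl = C
  ... | no  _    = T j

  [≔]-all : (Q : (j : Fin p) → Sub (Fin (n j)) → Set) → ∀ {T i C} →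
    Q i C → (∀ j → j ≢ i → Q j (T j)) → ∀ j → Q j ((T [ i ≔ C ]) j)
  [≔]-all Q {i = i} Q₍C₎ Q₍T₎ j with j Fin.≟ i
  ... | yes refl = Q₍C₎
  ... | no  j≢i  = Q₍T₎ j j≢i

  [≔]-at : ∀ T i C v → (T [ i ≔ C ]) i v ≡ C v
  [≔]-at T i C v with i Fin.≟ i
  ... | yes refl = refl
  ... | no  i≢i  = contradiction refl i≢i

  [≔]-off : ∀ T i C {j} v → j ≢ i → (T [ i ≔ C ]) j v ≡ T j v
  [≔]-off T i C {j} v j≢i with j Fin.≟ i
  ... | yes j≡i = contradiction j≡i j≢i
  ... | no  _   = refl

  [≔]-≐ : ∀ {T T' i C} → C ≐ T' i → (∀ j → j ≢ i → T j ≐ T' j) → ⋃ (T [ i ≔ C ]) ≐ ⋃ T'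
  [≔]-≐ {i = i} C≐T'₍i₎ T≐T' (j , v) with j Fin.≟ i
  ... | yes refl = C≐T'₍i₎ v
  ... | no  j≢i  = T≐T' j j≢i v

  [≔]-cong : ∀ {T i C C'} → C ≐ C' → ⋃ (T [ i ≔ C ]) ≐ ⋃ (T [ i ≔ C' ])
  [≔]-cong {T} {i} {C' = C'} C≐C' =
    [≔]-≐ (≐-trans C≐C' (≐-sym ([≔]-at T i C'))) (λ j j≢i v → sym ([≔]-off T i C' v j≢i))

  [≔]-diffIsOne : ∀ {T i A B} → DiffIsOne A B → DiffIsOne (⋃ (T [ i ≔ A ])) (⋃ (T [ i ≔ B ]))
  [≔]-diffIsOne {T} {i} {A} {B} (v , (Bv , ¬Av) , unique) =
    (i , v) , (trans ([≔]-at T i B v) Bv , trans ([≔]-at T i A v) ¬Av) , unique'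
    where
    unique' : ∀ w → ⋃ (T [ i ≔ B ]) w ≡ true → ⋃ (T [ i ≔ A ]) w ≡ false → w ≡ (i , v)
    unique' (j , u) Bu ¬Au with j Fin.≟ i
    ... | yes refl = cong (j ,_) (unique u Bu ¬Au)
    ... | no  _    = ⊥-elim (Bool.not-¬ Bu ¬Au)

Fin-argmin : ∀ {p} (f : Fin p → ℕ) → Fin p → ∃ λ i → ∀ j → f i ≤ f j
Fin-argmin f i₀ =
  argmin f i₀ (allFin _) , λ j → All.lookup (f[argmin]≤f[xs] i₀ (allFin _)) (∈-allFin j)

-- The conjunctive compound

module _ {p : ℕ} {n : Fin p → ℕ} (ℋ : (i : Fin p) → Family (Fin (n i))) where

  private
    𝒞 : Family (Union p n)
    𝒞 = Compound p n ℋ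

  ⋃-∈ : ∀ {T} → (∀ i → ℋ i (T i)) → 𝒞 (⋃ T)
  ⋃-∈ {T} T∈ℋ = T , T∈ℋ , λ _ _ → refl

  [≔]-∈ : ∀ {T i C} → (∀ j → ℋ j (T j)) → ℋ i C → 𝒞 (⋃ (T [ i ≔ C ]))
  [≔]-∈ T∈ℋ C∈ℋ = ⋃-∈ ([≔]-all (λ j → ℋ j) C∈ℋ (λ j _ → T∈ℋ j))

  Compound-resp : ∀ {E E'} → E ≐ E' → 𝒞 E → 𝒞 E'
  Compound-resp E≐E' (T , T∈ℋ , E≐T) = T , T∈ℋ , λ i v → trans (sym (E≐E' (i , v))) (E≐T i v)

  components-⊆ : ∀ {E S} {T : Tuple p n} → (∀ i v → E (i , v) ≡ T i v) → E ⊆ S →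
    ∀ i → T i ⊆ curry S i
  components-⊆ E≐T E⊆S i v T₍i₎v = E⊆S (i , v) (trans (E≐T i v) T₍i₎v)

  compound-isHypergraph : Fin p → (∀ i → IsHypergraph (ℋ i)) → (∀ i → ∃ λ H → ℋ i H) →
    IsHypergraph 𝒞
  compound-isHypergraph i₀ hypergraph edge = nonempty , covering
    where
    nonempty : ∀ E → 𝒞 E → ∃ λ w → E w ≡ true
    nonempty E (T , T∈ℋ , E≐T) with proj₁ (hypergraph i₀) (T i₀) (T∈ℋ i₀)
    ... | v , T₍i₀₎v = (i₀ , v) , trans (E≐T i₀ v) T₍i₀₎v

    covering : ∀ w → ∃ λ E → 𝒞 E × E w ≡ true
    covering (i , v) with proj₂ (hypergraph i) v
    ... | H , H∈ℋ , Hv = ⋃ (T₀ [ i ≔ H ]) , [≔]-∈ (proj₂ ∘ edge) H∈ℋ , trans ([≔]-at T₀ i H v) Hv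
      where
      T₀ : Tuple p n
      T₀ j = proj₁ (edge j)

  Move-combine : ∀ {x x'} → (∀ i → Move (ℋ i) (curry x i) (curry x' i)) → Move 𝒞 x x'
  Move-combine moves =
    ⋃ (proj₁ ∘ moves) , ⋃-∈ (proj₁ ∘ proj₂ ∘ moves) , λ (i , v) → proj₂ (proj₂ (moves i)) v

  Move-project : ∀ {x x'} → Move 𝒞 x x' → ∀ i → Move (ℋ i) (curry x i) (curry x' i)
  Move-project (E , (T , T∈ℋ , E≐T) , moves) i =
    T i , T∈ℋ i ,
    λ v → proj₁ (moves (i , v)) ∘ trans (E≐T i v) , proj₂ (moves (i , v)) ∘ trans (E≐T i v)

  Play-combine : ∀ {x} k → (∀ i → Play (ℋ i) (curry x i) k) → Play 𝒞 x k
  Play-combine zero    _     = done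
  Play-combine {x} (suc k) plays =
    step {x' = x'} (Move-combine (proj₁ ∘ proj₂ ∘ next)) (Play-combine k (proj₂ ∘ proj₂ ∘ next))
    where
    next : ∀ i → ∃ λ y → Move (ℋ i) (curry x i) y × Play (ℋ i) y k
    next i = Play-uncons (plays i)
    x' : Position (Union p n)
    x' (i , v) = proj₁ (next i) v

  Play-project : ∀ {x k} → Play 𝒞 x k → ∀ i → Play (ℋ i) (curry x i) k
  Play-project done             i = done
  Play-project (step move play) i = step (Move-project move i) (Play-project play i)

  compound-isHeight : ∀ {x} (h : Fin p → ℕ) → (∀ i → IsHeight (ℋ i) (curry x i) (h i)) →
    ∀ i₀ → (∀ i → h i₀ ≤ h i) → IsHeight 𝒞 x (h i₀)
  compound-isHeight h heights i₀ h₍i₀₎-min =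
    Play-combine (h i₀) (λ i → Play-truncate (h₍i₀₎-min i) (proj₁ (heights i))) ,
    λ j play → proj₂ (heights i₀) j (Play-project play i₀)

  compound-minimumDecreasing : ∀ {x x'} → Fin p →
    (∀ i → MinimumDecreasingMove (ℋ i) (curry x i) (curry x' i)) → MinimumDecreasingMove 𝒞 x x'
  compound-minimumDecreasing {x} {x'} i₀ decreasing =
    Move-combine (proj₁ ∘ decreasing) , ((i₁ , j i₁) , below) ,
    (k iₖ , compound-isHeight (suc ∘ k) (proj₁ ∘ heights) iₖ (s≤s ∘ k-min) ,
            compound-isHeight k (proj₂ ∘ heights) iₖ k-min) ,
    λ (i , v) → proj₂ (proj₂ (proj₂ (decreasing i))) v
    where
    j : ∀ i → Fin (n i)
    j i = proj₁ (proj₁ (proj₂ (decreasing i)))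
    k : Fin p → ℕ
    k i = proj₁ (proj₁ (proj₂ (proj₂ (decreasing i))))
    heights : ∀ i → IsHeight (ℋ i) (curry x i) (suc (k i)) × IsHeight (ℋ i) (curry x' i) (k i)
    heights i = proj₂ (proj₁ (proj₂ (proj₂ (decreasing i))))
    i₁ : Fin p
    i₁ = proj₁ (Fin-argmin (λ i → x' (i , j i)) i₀)
    below : ∀ w → x' (i₁ , j i₁) < x w
    below (i , v) = ≤-<-trans (proj₂ (Fin-argmin (λ i → x' (i , j i)) i₀) i)
                              (proj₂ (proj₁ (proj₂ (decreasing i))) v)
    iₖ : Fin p
    iₖ = proj₁ (Fin-argmin k i₀)
    k-min : ∀ i → k iₖ ≤ k i
    k-min = proj₂ (Fin-argmin k i₀)

  compound-propB : Fin p → (∀ i → PropB (ℋ i)) → PropB 𝒞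
  compound-propB i₀ minDecreasing x x>0 = x' , compound-minimumDecreasing i₀ (proj₂ ∘ choice)
    where
    choice : ∀ i → ∃ λ y → MinimumDecreasingMove (ℋ i) (curry x i) y
    choice i = minDecreasing i (curry x i) (λ v → x>0 (i , v))
    x' : Position (Union p n)
    x' (i , v) = proj₁ (choice i) v

  -- Choosing in every factor an edge disjoint from the given component is a finite choice,
  -- which commutes with double negation.
  compound-transversalFree : (∀ i → TransversalFree (ℋ i)) → TransversalFree 𝒞
  compound-transversalFree free (E , (T , T∈ℋ , E≐T) , meetsAll) =
    sequence (RawMonad.rawApplicative ¬¬-Monad)
      (λ i → transversalFree⇒¬¬disjoint (free i) (T∈ℋ i)) noDisjointEdges
    where
    noDisjointEdges : ¬ (∀ i → ∃ λ D → ℋ i D × ¬ Meets (T i) D)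
    noDisjointEdges D with meetsAll (⋃ (proj₁ ∘ D)) (⋃-∈ (proj₁ ∘ proj₂ ∘ D))
    ... | (i , v) , Ev , Dv = proj₂ (proj₂ (D i)) (v , trans (sym (E≐T i v)) Ev , Dv)

  compound-restrictions : (∀ i → RestrictionsHaveTransversals (ℋ i)) →
    RestrictionsHaveTransversals 𝒞
  compound-restrictions restrictions S ((i , v) , S₍iv₎≡false) (E , (T , T∈ℋ , E≐T) , E⊆S)
    with restrictions i (curry S i) (v , S₍iv₎≡false) (T i , T∈ℋ i , components-⊆ E≐T E⊆S i)
  ... | D , (D∈ℋ , D⊆S) , D-meets = ⋃ (T [ i ≔ D ]) , ([≔]-∈ T∈ℋ D∈ℋ , ⊆S) , meets
    where
    ⊆S : ⋃ (T [ i ≔ D ]) ⊆ S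
    ⊆S (j , u) = [≔]-all (λ j C → C ⊆ curry S j) D⊆S (λ j _ → components-⊆ E≐T E⊆S j) j u

    meets : ∀ E' → Restrict 𝒞 S E' → Meets (⋃ (T [ i ≔ D ])) E'
    meets E' ((T' , T'∈ℋ , E'≐T') , E'⊆S)
      with D-meets (T' i) (T'∈ℋ i , components-⊆ E'≐T' E'⊆S i)
    ... | u , Du , T'u = (i , u) , trans ([≔]-at T i D u) Du , trans (E'≐T' i u) T'u

  module _ (another : (i : Fin p) → ∃ λ j → j ≢ i)
           (nonempty : ∀ i H → ℋ i H → ∃ λ v → H v ≡ true) where

    Path-lift : ∀ {U T} → (∀ j → ℋ j (T j)) → (∀ j → T j ⊆ U j) → ∀ i {A B} →
      Path (ℋ i) (DiffStep (U i)) A B →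
      Path 𝒞 (ChainStep (⋃ U)) (⋃ (T [ i ≔ A ])) (⋃ (T [ i ≔ B ]))
    Path-lift {U} {T} T∈ℋ T⊆U i = Path-map (λ C → ⋃ (T [ i ≔ C ])) [≔]-cong ([≔]-∈ T∈ℋ) lift
      where
      lift : ∀ {A B} → DiffStep (U i) A B → ChainStep (⋃ U) (⋃ (T [ i ≔ A ])) (⋃ (T [ i ≔ B ]))
      lift {A} {B} (A→B , A⊆U) = meet , [≔]-diffIsOne A→B , ⊆U
        where
        meet : Meets (⋃ (T [ i ≔ B ])) (⋃ (T [ i ≔ A ]))
        meet with another i
        ... | j , j≢i with nonempty j (T j) (T∈ℋ j)
        ...   | v , T₍j₎v = (j , v) , trans ([≔]-off T i B v j≢i) T₍j₎v ,
                                     trans ([≔]-off T i A v j≢i) T₍j₎v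
        ⊆U : ⋃ (T [ i ≔ A ]) ⊆ ⋃ U
        ⊆U (j , v) = [≔]-all (λ j C → C ⊆ U j) A⊆U (λ j _ → T⊆U j) j v

    module _ (linked : ∀ i → Linked (ℋ i)) {H H' : Tuple p n}
             (H∈ℋ : ∀ i → ℋ i (H i)) (H'∈ℋ : ∀ i → ℋ i (H' i)) where

      prefix : ℕ → Tuple p n
      prefix k j with toℕ j <? k
      ... | yes _ = H' j
      ... | no  _ = H j

      prefix-∈ : ∀ k j → ℋ j (prefix k j)
      prefix-∈ k j with toℕ j <? k
      ... | yes _ = H'∈ℋ j
      ... | no  _ = H∈ℋ j

      prefix-⊆ : ∀ k j → prefix k j ⊆ (H j ∪ H' j)
      prefix-⊆ k j with toℕ j <? k
      ... | yes _ = ⊆-∪ʳ (H j) (H' j)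
      ... | no  _ = ⊆-∪ˡ (H j) (H' j)

      prefix-below : ∀ {k j} → toℕ j < k → prefix k j ≡ H' j
      prefix-below {k} {j} j<k with toℕ j <? k
      ... | yes _   = refl
      ... | no  j≮k = contradiction j<k j≮k

      prefix-above : ∀ {k j} → ¬ toℕ j < k → prefix k j ≡ H j
      prefix-above {k} {j} j≮k with toℕ j <? k
      ... | yes j<k = contradiction j<k j≮k
      ... | no  _   = refl

      prefix-suc : ∀ {k j} → toℕ j ≢ k → prefix k j ≡ prefix (suc k) j
      prefix-suc {k} {j} j≢k with toℕ j <? k | toℕ j <? suc k
      ... | yes _   | yes _    = refl
      ... | no  _   | no  _    = refl
      ... | yes j<k | no  j≮1+k = contradiction (m<n⇒m<1+n j<k) j≮1+k
      ... | no  j≮k | yes j<1+k with m<1+n⇒m<n∨m≡n j<1+k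
      ...   | inj₁ j<k = contradiction j<k j≮k
      ...   | inj₂ j≡k = contradiction j≡k j≢k

      open Concat {ℋ = 𝒞} {R = ChainStep (⋃ H ∪ ⋃ H')} Compound-resp ChainStep-respˡ

      stage : ∀ {k} i → toℕ i ≡ k →
        Path 𝒞 (ChainStep (⋃ H ∪ ⋃ H')) (⋃ (prefix k)) (⋃ (prefix (suc k)))
      stage {k} i i≡k with linked i (H i) (H' i) (H∈ℋ i) (H'∈ℋ i)
      ... | A , A≐H , path =
        Path-respˡ start
          (Path-respʳ end (Path-lift {U = λ j → H j ∪ H' j} (prefix-∈ k) (prefix-⊆ k) i path))
        where
        start : ⋃ (prefix k [ i ≔ A ]) ≐ ⋃ (prefix k)
        start = [≔]-≐ (≐-trans A≐H (cong-app (sym (prefix-above (<-irrefl i≡k)))))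
                      (λ _ _ _ → refl)
        end : ⋃ (prefix k [ i ≔ H' i ]) ≐ ⋃ (prefix (suc k))
        end = [≔]-≐ (cong-app (sym (prefix-below (≤-reflexive (cong suc i≡k))))) λ j j≢i →
          cong-app (prefix-suc (j≢i ∘ toℕ-injective ∘ λ j≡k → trans j≡k (sym i≡k)))

      prefixes : ∀ k → k ≤ p → Path 𝒞 (ChainStep (⋃ H ∪ ⋃ H')) (⋃ (prefix 0)) (⋃ (prefix k))
      prefixes zero    _   = stop (⋃-∈ (prefix-∈ 0)) (λ _ → refl)
      prefixes (suc k) k<p = prefixes k (<⇒≤ k<p) ++ stage (fromℕ< k<p) (toℕ-fromℕ< k<p)

      compound-path : Path 𝒞 (ChainStep (⋃ H ∪ ⋃ H')) (⋃ H) (⋃ H')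
      compound-path = Path-respˡ first (Path-respʳ last (prefixes p ≤-refl))
        where
        first : ⋃ (prefix 0) ≐ ⋃ H
        first (j , v) = cong-app (prefix-above {0} {j} (λ ())) v
        last : ⋃ (prefix p) ≐ ⋃ H'
        last (j , v) = cong-app (prefix-below {p} {j} (toℕ<n j)) v

    compound-chainProperty : (∀ i → Linked (ℋ i)) → ChainProperty 𝒞
    compound-chainProperty linked E E' (H , H∈ℋ , E≐H) (H' , H'∈ℋ , E'≐H') _
      with path⇒chain (compound-path linked H∈ℋ H'∈ℋ)
    ... | q , Hs , (Hs∈𝒞 , steps) , first≡⋃H , last≐⋃H' =
      q , Hs , (Hs∈𝒞 , inside ∘ steps) ,
      ≐-trans first≐⋃H (≐-sym E≐⋃H) , ≐-trans last≐⋃H' (≐-sym E'≐⋃H')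
      where
      first≐⋃H : Hs fzero ≐ ⋃ H
      first≐⋃H = cong-app first≡⋃H
      E≐⋃H : E ≐ ⋃ H
      E≐⋃H (i , v) = E≐H i v
      E'≐⋃H' : E' ≐ ⋃ H'
      E'≐⋃H' (i , v) = E'≐H' i v
      inside : ∀ {A B} → ChainStep (⋃ H ∪ ⋃ H') A B → ChainStep (Hs fzero ∪ Hs (fromℕ q)) A B
      inside (meet , A→B , A⊆U) =
        meet , A→B , ⊆-respʳ (∪-cong (≐-sym first≐⋃H) (≐-sym last≐⋃H')) A⊆U

distinct-index : ∀ {p} → 2 ≤ p → (i : Fin p) → ∃ λ j → j ≢ i
distinct-index (s≤s (s≤s z≤n)) fzero    = fsuc fzero , λ ()
distinct-index (s≤s (s≤s z≤n)) (fsuc _) = fzero , λ ()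

theorem1 : (p : ℕ) → 2 ≤ p → (n : Fin p → ℕ) →
    (ℋ : (i : Fin p) → Family (Fin (n i))) →
    (∀ i → IsHypergraph (ℋ i) × (JMplus (ℋ i) ⊎ IsTwoChooseOne (ℋ i))) →
    IsHypergraph (Compound p n ℋ) × JMplus (Compound p n ℋ)
theorem1 p 2≤p n ℋ factors =
  compound-isHypergraph ℋ i₀ hypergraph (propB⇒edge ∘ minDecreasing) ,
  (compound-transversalFree ℋ transversalFree , compound-restrictions ℋ restrictions) ,
  compound-propB ℋ i₀ minDecreasing ,
  compound-chainProperty ℋ (distinct-index 2≤p) (proj₁ ∘ hypergraph) linked
  where
  i₀ : Fin p
  i₀ = fromℕ< (≤-trans (s≤s z≤n) 2≤p)
  hypergraph : ∀ i → IsHypergraph (ℋ i)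
  hypergraph = proj₁ ∘ factors
  transversalFree : ∀ i → TransversalFree (ℋ i)
  transversalFree i = Sum.[ proj₁ ∘ proj₁ , twoChooseOne-transversalFree ] (proj₂ (factors i))
  restrictions : ∀ i → RestrictionsHaveTransversals (ℋ i)
  restrictions i = Sum.[ proj₂ ∘ proj₁ , twoChooseOne-restrictions ] (proj₂ (factors i))
  minDecreasing : ∀ i → PropB (ℋ i)
  minDecreasing i = Sum.[ proj₁ ∘ proj₂ , twoChooseOne-propB ] (proj₂ (factors i))
  linked : ∀ i → Linked (ℋ i)
  linked i = Sum.[ chainProperty⇒linked ∘ proj₂ ∘ proj₂ , twoChooseOne-linked ] (proj₂ (factors i))
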